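{- Let $k\ge 2$ and $n_1,\ldots,n_k\ge 2$ be integers, and let $G$ be the complete multipartite graph $K_{n_1,\ldots,n_k}$. Then player A wins the general position avoidance game on $G$ if and only if $k$ is even and at least one $n_i$ is even.
   Context: All graphs are finite and simple. A set $S$ of vertices of a graph $G$ is a general position set if no three distinct vertices of $S$ lie on a common shortest path (geodesic) of $G$. In the general position avoidance game on $G$, two players A and B alternately select vertices of $G$, with A moving first; a selection is legal if the vertex was not selected before and the set of all vertices selected so far is a general position set of $G$. The game ends when no legal move remains; the player who selects the last vertex loses (equivalently, the first player unable to move wins). "Player X wins" means X has a winning strategy. -}

module Defs where

open import Data.Nat using (ℕ; _≤_)
open import Data.Fin using (Fin)
open import Data.Product using (Σ; ∃; _×_; _,_; proj₁)
open import Data.List using (List; []; _∷_; length)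
open import Data.List.Membership.Propositional using (_∈_; _∉_)
open import Relation.Binary.PropositionalEquality using (_≡_; _≢_)
open import Relation.Nullary using (¬_)

record Graph : Set₁ where
  field
    V   : Set
    Adj : V → V → Set

module _ (G : Graph) where
  open Graph G

  -- IsWalk x y p : the vertex list p is a walk from x to y
  -- (consecutive vertices adjacent); its length (number of edges) is length p - 1.
  data IsWalk : V → V → List V → Set where
    here : ∀ {x} → IsWalk x x (x ∷ [])
    step : ∀ {x y z p} → Adj x y → IsWalk y z p → IsWalk x z (x ∷ p)

  IsGeodesic : V → V → List V → Set
  IsGeodesic x y p = IsWalk x y p × (∀ q → IsWalk x y q → length p ≤ length q)

  OnCommonGeodesic : V → V → V → Set
  OnCommonGeodesic a b c =
    Σ V λ x → Σ V λ y → Σ (List V) λ p →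
      IsGeodesic x y p × a ∈ p × b ∈ p × c ∈ p

  GeneralPosition : List V → Set
  GeneralPosition S = ∀ a b c → a ∈ S → b ∈ S → c ∈ S →
    a ≢ b → b ≢ c → a ≢ c → ¬ OnCommonGeodesic a b c

  -- Position of the game = list of vertices selected so far.
  -- Selecting v is legal if v was not selected and the new set is in general position.
  Legal : List V → V → Set
  Legal S v = v ∉ S × GeneralPosition (v ∷ S)

  -- Avoidance game: a player with no legal move wins (the one who selected the last vertex loses).
  data ToMoveWins (S : List V) : Set
  data ToMoveLoses (S : List V) : Set

  data ToMoveWins S where
    stuck : (∀ v → ¬ Legal S v) → ToMoveWins S
    move  : ∀ v → Legal S v → ToMoveLoses (v ∷ S) → ToMoveWins S

  data ToMoveLoses S where
    forced : (Σ V λ v → Legal S v) →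
             (∀ v → Legal S v → ToMoveWins (v ∷ S)) → ToMoveLoses S

  AWins : Set
  AWins = ToMoveWins []

CompleteMultipartite : (k : ℕ) → (Fin k → ℕ) → Graph
CompleteMultipartite k n = record
  { V   = Σ (Fin k) (λ i → Fin (n i))
  ; Adj = λ u v → proj₁ u ≢ proj₁ v
  }

-- In K_{n_1,...,n_k} two distinct vertices are at distance 1 or 2 according as
-- they lie in different parts or in the same part, so the only geodesics through
-- three vertices are bends x m y with x, y in one part and m in another. Hence a
-- general position set lies inside one part or meets every part at most once, and
-- after two moves the game is frozen into one of these shapes: the second vertex
-- either shares the part of the first, and the game lasts exactly n_i moves, or
-- it does not, and the game lasts exactly k moves. In a game of fixed length the
-- player who has to move when an even number of moves remain wins, so A wins iff
-- k is even and A can open in a part of even size.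
module Submission where

open import Defs
open import Data.Nat using (ℕ; zero; suc; _+_; _∸_; _≤_; _<_; z≤n; s≤s; z<s; parity)
open import Data.Nat.Properties
  using ( ≤⇒≯; <⇒≱; n≮n; n<1+n; m<m+n; m≤n⇒m≤1+n; +-suc; +-identityʳ; m+[n∸m]≡n
        ; ≤-refl; ≤-trans)
open import Data.Nat.Divisibility
  using (_∣_; _∣0; ∣-refl; ∣m∣n⇒∣m+n; ∣m+n∣m⇒∣n; ∣⇒≤)
open import Data.Parity.Base using (Parity; 0ℙ; 1ℙ; _⁻¹)
open import Data.Parity.Properties using (suc-homo-⁻¹)
open import Data.Fin using (Fin; fromℕ<; _≟_)
open import Data.Product using (Σ; ∃; _×_; _,_; proj₁)
open import Data.Product.Properties using (≡-dec)
open import Data.Product.Function.NonDependent.Propositional using (_×-⇔_)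
open import Data.Product.Function.Dependent.Propositional using (Σ-⇔)
open import Data.List using (List; []; _∷_; length; map; allFin)
open import Data.List.Properties using (length-map; length-tabulate; length-removeAt′)
open import Data.List.Membership.Propositional using (_∈_; _∉_; find)
open import Data.List.Membership.Propositional.Properties using (∈-map⁺; ∈-map⁻; ∈-allFin)
open import Data.List.Relation.Unary.Any using (here; there; _─_)
open import Data.List.Relation.Unary.All as All using (All; []; _∷_; all?)
open import Data.List.Relation.Unary.All.Properties using (¬Any⇒All¬; ¬All⇒Any¬)
open import Data.List.Relation.Unary.AllPairs using ([]; _∷_)
open import Data.List.Relation.Unary.Unique.Propositional using (Unique)
import Data.List.Relation.Unary.Unique.Propositional.Properties as Unique
open import Function using (_∘_)
open import Function.Bundles using (_⇔_; mk⇔; module Equivalence)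
open import Function.Construct.Composition using (_⇔-∘_)
open import Function.Construct.Identity using (↠-id)
open import Relation.Binary.Definitions using (DecidableEquality)
open import Relation.Binary.PropositionalEquality
  using (_≡_; _≢_; refl; sym; trans; cong; subst; subst₂)
open import Relation.Nullary using (¬_; yes; no; contradiction)

module _ {A : Set} where

  ∈-─ : ∀ {x y : A} {ys} (x∈ys : x ∈ ys) → y ∈ ys → y ≢ x → y ∈ (ys ─ x∈ys)
  ∈-─ (here refl) (here refl) y≢x = contradiction refl y≢x
  ∈-─ (here refl) (there y∈ys) _ = y∈ys
  ∈-─ (there x∈ys) (here refl) _ = here refl
  ∈-─ (there x∈ys) (there y∈ys) y≢x = there (∈-─ x∈ys y∈ys y≢x)

  unique-⊆⇒length≤ : ∀ {xs ys : List A} → Unique xs → (∀ {z} → z ∈ xs → z ∈ ys) →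
                     length xs ≤ length ys
  unique-⊆⇒length≤ {[]} _ _ = z≤n
  unique-⊆⇒length≤ {x ∷ xs} {ys} (x∉xs ∷ unique) xs⊆ys =
    subst (suc (length xs) ≤_) (sym (length-removeAt′ ys _))
      (s≤s (unique-⊆⇒length≤ unique λ z∈xs →
        ∈-─ x∈ys (xs⊆ys (there z∈xs)) (λ z≡x → All.lookup x∉xs z∈xs (sym z≡x))))
    where
      x∈ys : x ∈ ys
      x∈ys = xs⊆ys (here refl)

  distinct-triple⇒3≤length : ∀ {a b c : A} {xs} → a ≢ b → b ≢ c → a ≢ c →
                             a ∈ xs → b ∈ xs → c ∈ xs → 3 ≤ length xs
  distinct-triple⇒3≤length a≢b b≢c a≢c a∈ b∈ c∈ =
    unique-⊆⇒length≤ ((a≢b ∷ a≢c ∷ []) ∷ (b≢c ∷ []) ∷ [] ∷ [])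
      λ { (here refl) → a∈ ; (there (here refl)) → b∈ ; (there (there (here refl))) → c∈ }

  module _ (_≟ᴬ_ : DecidableEquality A) where
    open import Data.List.Membership.DecPropositional _≟ᴬ_ using (_∈?_)

    length<⇒∃∉ : ∀ {xs ys : List A} → Unique ys → length xs < length ys →
                 ∃ λ y → y ∈ ys × y ∉ xs
    length<⇒∃∉ {xs} {ys} unique xs<ys with all? (_∈? xs) ys
    ... | yes ys⊆xs = contradiction (unique-⊆⇒length≤ unique (All.lookup ys⊆xs)) (<⇒≱ xs<ys)
    ... | no ys⊈xs = find (¬All⇒Any¬ (_∈? xs) ys ys⊈xs)

length-allFin : ∀ m → length (allFin m) ≡ m
length-allFin m = length-tabulate (λ (i : Fin m) → i)

parity≡0ℙ⇔2∣ : ∀ m → parity m ≡ 0ℙ ⇔ 2 ∣ m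
parity≡0ℙ⇔2∣ zero = mk⇔ (λ _ → 2 ∣0) (λ _ → refl)
parity≡0ℙ⇔2∣ (suc zero) = mk⇔ (λ ()) (λ 2∣1 → contradiction (∣⇒≤ 2∣1) λ { (s≤s ()) })
parity≡0ℙ⇔2∣ (suc (suc m)) =
  mk⇔ (∣m∣n⇒∣m+n ∣-refl ∘ to) λ 2∣2+m → from (∣m+n∣m⇒∣n 2∣2+m ∣-refl)
  where open Equivalence (parity≡0ℙ⇔2∣ m)

parity-∸2 : ∀ {m} → 2 ≤ m → parity (m ∸ 2) ≡ parity m
parity-∸2 (s≤s (s≤s _)) = refl

module _ (G : Graph) where
  open Graph G

  short⇒generalPosition : ∀ {S} → length S ≤ 2 → GeneralPosition G S
  short⇒generalPosition S≤2 a b c a∈ b∈ c∈ a≢b b≢c a≢c _ =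
    ≤⇒≯ S≤2 (distinct-triple⇒3≤length a≢b b≢c a≢c a∈ b∈ c∈)

  firstMove-legal : ∀ v → Legal G [] v
  firstMove-legal v = (λ ()) , short⇒generalPosition (s≤s z≤n)

  secondMove-legal : ∀ {u v} → u ≢ v → Legal G (v ∷ []) u
  secondMove-legal u≢v = (λ { (here u≡v) → u≢v u≡v }) , short⇒generalPosition ≤-refl

  walk-nonempty : ∀ {x y p} → IsWalk G x y p → 0 < length p
  walk-nonempty here = z<s
  walk-nonempty (step _ _) = z<s

  wins⇒¬loses : ∀ {S} → ToMoveWins G S → ¬ ToMoveLoses G S
  wins⇒¬loses (stuck noMove) (forced (v , legal) _) = noMove v legal
  wins⇒¬loses (move v legal loses) (forced _ wins) = wins⇒¬loses (wins v legal) loses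

  Outcome : Parity → List V → Set
  Outcome 0ℙ = ToMoveWins G
  Outcome 1ℙ = ToMoveLoses G

  outcome-wins⇒0ℙ : ∀ {p S} → Outcome p S → ToMoveWins G S → p ≡ 0ℙ
  outcome-wins⇒0ℙ {0ℙ} _ _ = refl
  outcome-wins⇒0ℙ {1ℙ} loses wins = contradiction loses (wins⇒¬loses wins)

  outcome-step : ∀ {S} p → ∃ (Legal G S) → (∀ v → Legal G S v → Outcome p (v ∷ S)) →
                 Outcome (p ⁻¹) S
  outcome-step 0ℙ someMove replies = forced someMove replies
  outcome-step 1ℙ (v , legal) replies = move v legal (replies v legal)

  record Countdown : Set₁ where
    field
      Remaining : ℕ → List V → Set
      exhausted : ∀ {S} → Remaining 0 S → ∀ v → ¬ Legal G S v
      available : ∀ {r S} → Remaining (suc r) S → ∃ (Legal G S)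
      consume   : ∀ {r S v} → Remaining (suc r) S → Legal G S v → Remaining r (v ∷ S)

  countdown-outcome : (c : Countdown) → ∀ r {S} → Countdown.Remaining c r S → Outcome (parity r) S
  countdown-outcome c zero remaining = stuck (exhausted remaining)
    where open Countdown c
  countdown-outcome c (suc r) {S} remaining =
    subst (λ p → Outcome p S) (suc-homo-⁻¹ (suc r))
      (outcome-step (parity r) (available remaining)
        λ v legal → countdown-outcome c r (consume remaining legal))
    where open Countdown c

module Multipartite (k : ℕ) (n : Fin k → ℕ) (2≤k : 2 ≤ k) (2≤n : ∀ i → 2 ≤ n i) where

  K : Graph
  K = CompleteMultipartite k n

  Vertex : Set
  Vertex = Σ (Fin k) (λ i → Fin (n i))

  part : Vertex → Fin k
  part = proj₁

  _≟ᵥ_ : DecidableEquality Vertex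
  _≟ᵥ_ = ≡-dec _≟_ _≟_

  point : ∀ i → Fin (n i)
  point i = fromℕ< (2≤n i)

  vertex : ∀ i → Fin (n i) → Vertex
  vertex i a = i , a

  partVertices : Fin k → List Vertex
  partVertices i = map (vertex i) (allFin (n i))

  length-partVertices : ∀ i → length (partVertices i) ≡ n i
  length-partVertices i = trans (length-map (vertex i) (allFin (n i))) (length-allFin (n i))

  partVertices-unique : ∀ i → Unique (partVertices i)
  partVertices-unique i = Unique.map⁺ (λ { refl → refl }) (Unique.allFin⁺ (n i))

  ∈-partVertices : ∀ {v} → v ∈ partVertices (part v)
  ∈-partVertices {i , a} = ∈-map⁺ (vertex i) (∈-allFin a)

  ∈-partVertices⁻ : ∀ {v i} → v ∈ partVertices i → part v ≡ i
  ∈-partVertices⁻ v∈ with ∈-map⁻ _ v∈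
  ... | _ , _ , refl = refl

  withinPart⇒length≤ : ∀ {i S} → Unique S → All (λ s → part s ≡ i) S → length S ≤ n i
  withinPart⇒length≤ {i} unique within =
    subst (_ ≤_) (length-partVertices i)
      (unique-⊆⇒length≤ unique λ s∈ →
        subst (λ j → _ ∈ partVertices j) (All.lookup within s∈) ∈-partVertices)

  distinctParts⇒length≤ : ∀ {S} → Unique (map part S) → length S ≤ k
  distinctParts⇒length≤ {S} distinct =
    subst₂ _≤_ (length-map part S) (length-allFin k)
      (unique-⊆⇒length≤ distinct (λ {i} _ → ∈-allFin i))

  freeVertex : ∀ {i} S → length S < n i → ∃ λ v → part v ≡ i × v ∉ S
  freeVertex {i} S S<ni with length<⇒∃∉ _≟ᵥ_ (partVertices-unique i)
                               (subst (length S <_) (sym (length-partVertices i)) S<ni)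
  ... | v , v∈ , v∉S = v , ∈-partVertices⁻ v∈ , v∉S

  freePart : ∀ is → length is < k → ∃ λ j → j ∉ is
  freePart is is<k with length<⇒∃∉ _≟_ (Unique.allFin⁺ k)
                          (subst (length is <_) (sym (length-allFin k)) is<k)
  ... | j , _ , j∉is = j , j∉is

  elsewhere : ∀ i → ∃ λ w → part w ≢ i
  elsewhere i with freePart (i ∷ []) 2≤k
  ... | j , j∉[i] = (j , point j) , λ j≡i → j∉[i] (here j≡i)

  partner : ∀ v → ∃ λ u → part u ≡ part v × u ≢ v
  partner v with freeVertex (v ∷ []) (2≤n (part v))
  ... | u , u≈v , u∉[v] = u , u≈v , λ u≡v → u∉[v] (here u≡v)

  samePart-walk-length≥3 : ∀ {x y q} → part x ≡ part y → x ≢ y → IsWalk K x y q →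
                           3 ≤ length q
  samePart-walk-length≥3 _ x≢y here = contradiction refl x≢y
  samePart-walk-length≥3 x≈y _ (step x~y here) = contradiction x≈y x~y
  samePart-walk-length≥3 _ _ (step _ (step _ w)) = s≤s (s≤s (walk-nonempty K w))

  bend-isWalk : ∀ {x m y} → part x ≡ part y → part m ≢ part x →
                IsWalk K x y (x ∷ m ∷ y ∷ [])
  bend-isWalk x≈y m≁x = step (m≁x ∘ sym) (step (λ m≈y → m≁x (trans m≈y (sym x≈y))) here)

  bend-isGeodesic : ∀ {x m y} → part x ≡ part y → x ≢ y → part m ≢ part x →
                    IsGeodesic K x y (x ∷ m ∷ y ∷ [])
  bend-isGeodesic x≈y x≢y m≁x = bend-isWalk x≈y m≁x , λ _ → samePart-walk-length≥3 x≈y x≢y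

  shortcut : ∀ x y → ∃ λ q → IsWalk K x y q × length q ≤ 3
  shortcut x y with part x ≟ part y | elsewhere (part x)
  ... | no x≁y | _ = x ∷ y ∷ [] , step x≁y here , s≤s (s≤s z≤n)
  ... | yes x≈y | w , w≁x = x ∷ w ∷ y ∷ [] , bend-isWalk x≈y w≁x , ≤-refl

  geodesic-length≤3 : ∀ {x y p} → IsGeodesic K x y p → length p ≤ 3
  geodesic-length≤3 {x} {y} (_ , minimal) with shortcut x y
  ... | q , walk , q≤3 = ≤-trans (minimal q walk) q≤3

  long-geodesic⇒bend : ∀ {x y p} → IsGeodesic K x y p → 3 ≤ length p →
                       ∃ λ m → p ≡ x ∷ m ∷ y ∷ [] × part x ≡ part y × part m ≢ part x
  long-geodesic⇒bend (here , _) (s≤s ())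
  long-geodesic⇒bend (step _ here , _) (s≤s (s≤s ()))
  long-geodesic⇒bend {x} {y} (step {y = m} x~m (step _ here) , minimal) _
    with part x ≟ part y
  ... | yes x≈y = m , refl , x≈y , x~m ∘ sym
  ... | no x≁y = contradiction (n<1+n 2) (≤⇒≯ (minimal (x ∷ y ∷ []) (step x≁y here)))
  long-geodesic⇒bend geodesic@(step _ (step _ (step _ w)) , _) _ =
    contradiction (s≤s (s≤s (s≤s (walk-nonempty K w)))) (≤⇒≯ (geodesic-length≤3 geodesic))

  bend-within-part : ∀ {x m y} i → part x ≡ part y → part m ≢ part x →
                     ∃ λ L → length L ≤ 2 × (∀ {z} → z ∈ x ∷ m ∷ y ∷ [] → part z ≡ i → z ∈ L)
  bend-within-part {x} {m} {y} i x≈y m≁x with part x ≟ i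
  ... | yes x∈i = x ∷ y ∷ [] , ≤-refl , λ where
    (here refl) _ → here refl
    (there (here refl)) m∈i → contradiction (trans m∈i (sym x∈i)) m≁x
    (there (there (here refl))) _ → there (here refl)
  ... | no x∉i = m ∷ [] , s≤s z≤n , λ where
    (here refl) x∈i → contradiction x∈i x∉i
    (there (here refl)) _ → here refl
    (there (there (here refl))) y∈i → contradiction (trans x≈y y∈i) x∉i

  bend-parts : ∀ {x m y z} → part x ≡ part y → z ∈ x ∷ m ∷ y ∷ [] →
               part z ∈ part x ∷ part m ∷ []
  bend-parts _ (here refl) = here refl
  bend-parts _ (there (here refl)) = there (here refl)
  bend-parts x≈y (there (there (here refl))) = here (sym x≈y)

  samePart⇒generalPosition : ∀ {i S} → All (λ s → part s ≡ i) S → GeneralPosition K S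
  samePart⇒generalPosition {i} within a b c a∈ b∈ c∈ a≢b b≢c a≢c
    (x , y , p , geodesic , a∈p , b∈p , c∈p)
    with long-geodesic⇒bend geodesic (distinct-triple⇒3≤length a≢b b≢c a≢c a∈p b∈p c∈p)
  ... | m , refl , x≈y , m≁x with bend-within-part i x≈y m≁x
  ...   | L , L≤2 , bend∩i⊆L =
    ≤⇒≯ L≤2 (distinct-triple⇒3≤length a≢b b≢c a≢c
      (bend∩i⊆L a∈p (All.lookup within a∈)) (bend∩i⊆L b∈p (All.lookup within b∈))
      (bend∩i⊆L c∈p (All.lookup within c∈)))

  distinctParts⇒≢ : ∀ {S a b} → Unique (map part S) → a ∈ S → b ∈ S → a ≢ b →
                    part a ≢ part b
  distinctParts⇒≢ (_ ∷ _) (here refl) (here refl) a≢b = contradiction refl a≢b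
  distinctParts⇒≢ (a∉ ∷ _) (here refl) (there b∈) _ = All.lookup a∉ (∈-map⁺ part b∈)
  distinctParts⇒≢ (b∉ ∷ _) (there a∈) (here refl) _ = All.lookup b∉ (∈-map⁺ part a∈) ∘ sym
  distinctParts⇒≢ (_ ∷ distinct) (there a∈) (there b∈) = distinctParts⇒≢ distinct a∈ b∈

  distinctParts⇒generalPosition : ∀ {S} → Unique (map part S) → GeneralPosition K S
  distinctParts⇒generalPosition distinct a b c a∈ b∈ c∈ a≢b b≢c a≢c
    (x , y , p , geodesic , a∈p , b∈p , c∈p)
    with long-geodesic⇒bend geodesic (distinct-triple⇒3≤length a≢b b≢c a≢c a∈p b∈p c∈p)
  ... | m , refl , x≈y , _ =
    ≤⇒≯ ≤-refl (distinct-triple⇒3≤length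
      (distinctParts⇒≢ distinct a∈ b∈ a≢b) (distinctParts⇒≢ distinct b∈ c∈ b≢c)
      (distinctParts⇒≢ distinct a∈ c∈ a≢c)
      (bend-parts x≈y a∈p) (bend-parts x≈y b∈p) (bend-parts x≈y c∈p))

  mixed⇒¬generalPosition : ∀ {T s t u} → s ∈ T → t ∈ T → u ∈ T → s ≢ t → part s ≡ part t →
                           part u ≢ part s → ¬ GeneralPosition K T
  mixed⇒¬generalPosition s∈ t∈ u∈ s≢t s≈t u≁s gp =
    gp _ _ _ s∈ u∈ t∈ (u≁s ∘ cong part ∘ sym) (λ u≡t → u≁s (trans (cong part u≡t) (sym s≈t))) s≢t
      (_ , _ , _ , bend-isGeodesic s≈t s≢t u≁s ,
       here refl , there (here refl) , there (there (here refl)))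

  record Filling (i : Fin k) (r : ℕ) (S : List Vertex) : Set where
    field
      unique : Unique S
      within : All (λ s → part s ≡ i) S
      pair   : 2 ≤ length S
      count  : length S + r ≡ n i

  filling-legal⇒within : ∀ {i r S v} → Filling i r S → Legal K S v → part v ≡ i
  filling-legal⇒within {S = []} record { pair = () }
  filling-legal⇒within {S = _ ∷ []} record { pair = s≤s () }
  filling-legal⇒within {i} {S = s ∷ t ∷ _} {v}
    record { unique = (s≢t ∷ _) ∷ _ ; within = s∈i ∷ t∈i ∷ _ } (_ , gp) with part v ≟ i
  ... | yes v∈i = v∈i
  ... | no v∉i =
    contradiction gp (mixed⇒¬generalPosition (there (here refl)) (there (there (here refl)))
      (here refl) s≢t (trans s∈i (sym t∈i)) (λ v≈s → v∉i (trans v≈s s∈i)))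

  filling : Fin k → Countdown K
  filling i = record
    { Remaining = Filling i
    ; exhausted = exhausted
    ; available = available
    ; consume   = consume
    }
    where
      exhausted : ∀ {S} → Filling i 0 S → ∀ v → ¬ Legal K S v
      exhausted {S} f v legal@(v∉S , _) =
        n≮n (length S) (subst (length (v ∷ S) ≤_) (trans (sym count) (+-identityʳ (length S)))
          (withinPart⇒length≤ (¬Any⇒All¬ S v∉S ∷ unique) (filling-legal⇒within f legal ∷ within)))
        where open Filling f

      available : ∀ {r S} → Filling i (suc r) S → ∃ (Legal K S)
      available {r} {S} f
        with freeVertex S (subst (length S <_) (Filling.count f) (m<m+n (length S) z<s))
      ... | v , v∈i , v∉S = v , v∉S , samePart⇒generalPosition (v∈i ∷ Filling.within f)

      consume : ∀ {r S v} → Filling i (suc r) S → Legal K S v → Filling i r (v ∷ S)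
      consume {r} {S} f legal@(v∉S , _) = record
        { unique = ¬Any⇒All¬ S v∉S ∷ unique
        ; within = filling-legal⇒within f legal ∷ within
        ; pair   = m≤n⇒m≤1+n pair
        ; count  = trans (sym (+-suc (length S) r)) count
        }
        where open Filling f

  record Spreading (r : ℕ) (S : List Vertex) : Set where
    field
      distinct : Unique (map part S)
      pair     : 2 ≤ length S
      count    : length S + r ≡ k

  spreading-legal⇒freshPart : ∀ {r S v} → Spreading r S → Legal K S v → part v ∉ map part S
  spreading-legal⇒freshPart {S = []} record { pair = () }
  spreading-legal⇒freshPart {S = _ ∷ []} record { pair = s≤s () }
  spreading-legal⇒freshPart {S = S@(s ∷ t ∷ _)} {v}
    record { distinct = (s≁t ∷ _) ∷ _ } (v∉S , gp) v∈parts
    with ∈-map⁻ part v∈parts | part v ≟ part s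
  ... | w , w∈S , v≈w | yes v≈s =
    contradiction gp (mixed⇒¬generalPosition (here refl) (there w∈S) (there (there (here refl)))
      (All.lookup (¬Any⇒All¬ S v∉S) w∈S) v≈w (λ t≈v → s≁t (trans (sym v≈s) (sym t≈v))))
  ... | w , w∈S , v≈w | no v≁s =
    contradiction gp (mixed⇒¬generalPosition (here refl) (there w∈S) (there (here refl))
      (All.lookup (¬Any⇒All¬ S v∉S) w∈S) v≈w (v≁s ∘ sym))

  spreading : Countdown K
  spreading = record
    { Remaining = Spreading
    ; exhausted = exhausted
    ; available = available
    ; consume   = consume
    }
    where
      exhausted : ∀ {S} → Spreading 0 S → ∀ v → ¬ Legal K S v
      exhausted {S} sp v legal =
        n≮n (length S) (subst (length (v ∷ S) ≤_) (trans (sym count) (+-identityʳ (length S)))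
          (distinctParts⇒length≤ {v ∷ S}
            (¬Any⇒All¬ _ (spreading-legal⇒freshPart sp legal) ∷ distinct)))
        where open Spreading sp

      available : ∀ {r S} → Spreading (suc r) S → ∃ (Legal K S)
      available {r} {S} sp
        with freePart (map part S) (subst (_< k) (sym (length-map part S))
                                     (subst (length S <_) (Spreading.count sp) (m<m+n (length S) z<s)))
      ... | j , j∉parts =
        (j , point j) , (λ v∈S → j∉parts (∈-map⁺ part v∈S)) ,
        distinctParts⇒generalPosition (¬Any⇒All¬ _ j∉parts ∷ Spreading.distinct sp)

      consume : ∀ {r S v} → Spreading (suc r) S → Legal K S v → Spreading r (v ∷ S)
      consume {r} {S} sp legal = record
        { distinct = ¬Any⇒All¬ _ (spreading-legal⇒freshPart sp legal) ∷ distinct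
        ; pair     = m≤n⇒m≤1+n pair
        ; count    = trans (sym (+-suc (length S) r)) count
        }
        where open Spreading sp

  samePartReply-outcome : ∀ {u v} → part u ≡ part v → u ≢ v →
                          Outcome K (parity (n (part v))) (u ∷ v ∷ [])
  samePartReply-outcome {u} {v} u≈v u≢v =
    subst (λ p → Outcome K p (u ∷ v ∷ [])) (parity-∸2 (2≤n (part v)))
      (countdown-outcome K (filling (part v)) (n (part v) ∸ 2) record
        { unique = (u≢v ∷ []) ∷ [] ∷ []
        ; within = u≈v ∷ refl ∷ []
        ; pair   = ≤-refl
        ; count  = m+[n∸m]≡n (2≤n (part v))
        })

  otherPartReply-outcome : ∀ {u v} → part u ≢ part v → Outcome K (parity k) (u ∷ v ∷ [])
  otherPartReply-outcome {u} {v} u≁v =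
    subst (λ p → Outcome K p (u ∷ v ∷ [])) (parity-∸2 2≤k)
      (countdown-outcome K spreading (k ∸ 2) record
        { distinct = (u≁v ∷ []) ∷ [] ∷ []
        ; pair     = ≤-refl
        ; count    = m+[n∸m]≡n 2≤k
        })

  A-wins⇔evenParities : AWins K ⇔ (parity k ≡ 0ℙ × ∃ λ i → parity (n i) ≡ 0ℙ)
  A-wins⇔evenParities = mk⇔ necessary sufficient
    where
      necessary : AWins K → parity k ≡ 0ℙ × ∃ λ i → parity (n i) ≡ 0ℙ
      necessary (stuck noMove) = contradiction (firstMove-legal K v₀) (noMove v₀)
        where v₀ = proj₁ (elsewhere (fromℕ< 2≤k))
      necessary (move v _ (forced _ repliesWin)) with elsewhere (part v) | partner v
      ... | w , w≁v | u , u≈v , u≢v =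
        outcome-wins⇒0ℙ K (otherPartReply-outcome w≁v)
          (repliesWin w (secondMove-legal K (w≁v ∘ cong part))) ,
        part v ,
        outcome-wins⇒0ℙ K (samePartReply-outcome u≈v u≢v) (repliesWin u (secondMove-legal K u≢v))

      sufficient : parity k ≡ 0ℙ × (∃ λ i → parity (n i) ≡ 0ℙ) → AWins K
      sufficient (k-even , i , nᵢ-even) with elsewhere i
      ... | w , w≁i =
        move v (firstMove-legal K v) (forced (w , secondMove-legal K (w≁i ∘ cong part)) replyLoses)
        where
          v = (i , point i)
          replyLoses : ∀ u → Legal K (v ∷ []) u → ToMoveWins K (u ∷ v ∷ [])
          replyLoses u (u∉[v] , _) with part u ≟ i
          ... | yes u≈v =
            subst (λ p → Outcome K p (u ∷ v ∷ [])) nᵢ-even (samePartReply-outcome u≈v (u∉[v] ∘ here))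
          ... | no u≁v =
            subst (λ p → Outcome K p (u ∷ v ∷ [])) k-even (otherPartReply-outcome u≁v)

proposition2p5 : (k : ℕ) → (n : Fin k → ℕ) → 2 ≤ k → (∀ i → 2 ≤ n i) →
    AWins (CompleteMultipartite k n) ⇔ (2 ∣ k × ∃ λ i → 2 ∣ n i)
proposition2p5 k n 2≤k 2≤n =
  (parity≡0ℙ⇔2∣ k ×-⇔ Σ-⇔ (↠-id _) (parity≡0ℙ⇔2∣ (n _)))
    ⇔-∘ Multipartite.A-wins⇔evenParities k n 2≤k 2≤n
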